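{- For a positive integer $n$, let $z(n)$ be the largest integer with $3z(n)<2n$, let $m(n)$ be the largest integer with $m(n)^2\le 2n$, and put $y(n)=2^{2n-2z(n)-m(n)+2}-n^{m(n)-1}$. Then $y(n)>0$ for every integer $n\ge 404$. -}

module Defs where

open import Data.Nat using (ℕ; _+_; _*_; _<_; _≤_; suc)
open import Data.Product using (_×_)
open import Relation.Nullary using (¬_)

-- z is the largest integer with 3z < 2n.  (Such z is ≥ 0 for n ≥ 1, so ℕ suffices.)
IsZ : ℕ → ℕ → Set
IsZ n z = (3 * z < 2 * n) × ¬ (3 * suc z < 2 * n)

IsM : ℕ → ℕ → Set
IsM n m = (m * m ≤ 2 * n) × ¬ (suc m * suc m ≤ 2 * n)

-- Write m = m(n) = 1 + j and d = 2n − m². Because 3z ≤ 2n − 1, the exponent satisfies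
-- 9e ≥ 6n + 15 − 9j, so the ninth power of n^j < 2^e follows from (2n)^(9j) ≤ 2^14 · 64^n.
-- We prove the stronger invariant (2n)^(9j) · 4^d ≤ 2^14 · 64^n for all n ≥ 404 by induction on n,
-- checking n = 404 by computation. Since 36j ≤ 3n, passing from n to n + 1 multiplies (2n)^(9j)
-- by at most 4, because (1 + 1/n)^k ≤ n/(n − k). If m(n + 1) = m(n), then d grows by 2 and the
-- left side by at most 4 · 16 = 64. If m(n + 1) = m(n) + 1, then d drops by 2j + 1, and the new
-- factor (2n + 2)^9 < (j + 3)^18 ≤ 4^(2j + 3) is paid for by that drop.
module Submission where

open import Defs
open import Data.Product using (_,_)
open import Function using (_∘_; case_of_)
open import Relation.Binary.PropositionalEquality
  using (_≡_; refl; sym; trans; cong; subst; module ≡-Reasoning)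
open import Relation.Nullary using (yes; no)

-- A separate scope, so that ℕ's _^_ does not clash with ℤ's _^_ in the theorem.
module _ where
  open import Data.Nat
  open import Data.Nat.Properties
  open import Data.List using (_∷_; [])
  open import Data.Nat.Tactic.RingSolver using (solve; solve-∀)
  open import Algebra.Properties.CommutativeSemigroup *-commutativeSemigroup
    using (interchange; x∙yz≈y∙xz; xy∙z≈y∙xz; xy∙z≈x∙zy; x∙yz≈xz∙y)

  ^-distribʳ-* : ∀ m n k → (m * n) ^ k ≡ m ^ k * n ^ k
  ^-distribʳ-* m n zero    = refl
  ^-distribʳ-* m n (suc k) =
    trans (cong (m * n *_) (^-distribʳ-* m n k)) (interchange m n (m ^ k) (n ^ k))

  [1+n]^k*d≤n^[1+k] : ∀ k d {n} → d + k ≡ n → suc n ^ k * d ≤ n ^ suc k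
  [1+n]^k*d≤n^[1+k] zero    d {n} d+0≡n = ≤-reflexive (trans d+0≡n (sym (*-identityʳ n)))
  [1+n]^k*d≤n^[1+k] (suc k) d {n} d+1+k≡n = begin
    suc n * a * d    ≡⟨ xy∙z≈y∙xz (suc n) a d ⟩
    a * (suc n * d)  ≤⟨ *-monoʳ-≤ a [1+n]d≤n[1+d] ⟩
    a * (n * suc d)  ≡⟨ x∙yz≈xz∙y a n (suc d) ⟩
    a * suc d * n    ≤⟨ *-monoˡ-≤ n ([1+n]^k*d≤n^[1+k] k (suc d) (trans (sym (+-suc d k)) d+1+k≡n)) ⟩
    n ^ suc k * n    ≡⟨ *-comm (n ^ suc k) n ⟩
    n ^ suc (suc k)  ∎
    where
    open ≤-Reasoning
    a = suc n ^ k
    [1+n]d≤n[1+d] : suc n * d ≤ n * suc d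
    [1+n]d≤n[1+d] = subst (d + n * d ≤_) (sym (*-suc n d))
      (+-monoˡ-≤ (n * d) (subst (d ≤_) d+1+k≡n (m≤m+n d (suc k))))

  [1+n]^k≤4*n^k : ∀ {n} k → 4 * k ≤ 3 * n → suc n ^ k ≤ 4 * n ^ k
  [1+n]^k≤4*n^k {zero}  zero    _  = s≤s z≤n
  [1+n]^k≤4*n^k {zero}  (suc k) ()
  [1+n]^k≤4*n^k {n@(suc _)} k 4k≤3n = *-cancelˡ-≤ n (begin
    n * suc n ^ k            ≤⟨ *-monoˡ-≤ (suc n ^ k) n≤4[n∸k] ⟩
    4 * (n ∸ k) * suc n ^ k  ≡⟨ xy∙z≈x∙zy 4 (n ∸ k) (suc n ^ k) ⟩
    4 * (suc n ^ k * (n ∸ k)) ≤⟨ *-monoʳ-≤ 4 ([1+n]^k*d≤n^[1+k] k (n ∸ k) (m∸n+n≡m k≤n)) ⟩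
    4 * (n * n ^ k)          ≡⟨ x∙yz≈y∙xz 4 n (n ^ k) ⟩
    n * (4 * n ^ k)          ∎)
    where
    open ≤-Reasoning
    k≤n : k ≤ n
    k≤n = *-cancelˡ-≤ 4 (≤-trans 4k≤3n (*-monoˡ-≤ n (≤ᵇ⇒≤ 3 4 _)))
    n≤4[n∸k] : n ≤ 4 * (n ∸ k)
    n≤4[n∸k] = begin
      n             ≡⟨ sym (m+n∸n≡m n (3 * n)) ⟩
      4 * n ∸ 3 * n ≤⟨ ∸-monoʳ-≤ (4 * n) 4k≤3n ⟩
      4 * n ∸ 4 * k ≡⟨ sym (*-distribˡ-∸ 4 n k) ⟩
      4 * (n ∸ k)   ∎

  [2+2n]^k≤4*[2n]^k : ∀ {n} k → 4 * k ≤ 3 * n → (2 * suc n) ^ k ≤ 4 * (2 * n) ^ k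
  [2+2n]^k≤4*[2n]^k {n} k 4k≤3n = begin
    (2 * suc n) ^ k      ≡⟨ ^-distribʳ-* 2 (suc n) k ⟩
    2 ^ k * suc n ^ k    ≤⟨ *-monoʳ-≤ (2 ^ k) ([1+n]^k≤4*n^k k 4k≤3n) ⟩
    2 ^ k * (4 * n ^ k)  ≡⟨ x∙yz≈y∙xz (2 ^ k) 4 (n ^ k) ⟩
    4 * (2 ^ k * n ^ k)  ≡⟨ cong (4 *_) (sym (^-distribʳ-* 2 n k)) ⟩
    4 * (2 * n) ^ k      ∎
    where open ≤-Reasoning

  [t+n]^k≤4^t*n^k : ∀ t {n k} → 4 * k ≤ 3 * n → (t + n) ^ k ≤ 4 ^ t * n ^ k
  [t+n]^k≤4^t*n^k zero    {n} {k} _     = ≤-reflexive (sym (+-identityʳ (n ^ k)))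
  [t+n]^k≤4^t*n^k (suc t) {n} {k} 4k≤3n = begin
    suc (t + n) ^ k         ≤⟨ [1+n]^k≤4*n^k k (≤-trans 4k≤3n (*-monoʳ-≤ 3 (m≤n+m n t))) ⟩
    4 * (t + n) ^ k         ≤⟨ *-monoʳ-≤ 4 ([t+n]^k≤4^t*n^k t {n} {k} 4k≤3n) ⟩
    4 * (4 ^ t * n ^ k)     ≡⟨ sym (*-assoc 4 (4 ^ t) (n ^ k)) ⟩
    4 ^ suc t * n ^ k       ∎
    where open ≤-Reasoning

  [3+j]²^9≤4^[3+2j] : ∀ {j} → 27 ≤ j → ((3 + j) * (3 + j)) ^ 9 ≤ 4 ^ (3 + 2 * j)
  [3+j]²^9≤4^[3+2j] {j} 27≤j = begin
    ((3 + j) * (3 + j)) ^ 9    ≡⟨ ^-distribʳ-* (3 + j) (3 + j) 9 ⟩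
    (3 + j) ^ 9 * (3 + j) ^ 9  ≡⟨ sym (^-distribˡ-+-* (3 + j) 9 9) ⟩
    (3 + j) ^ (9 + 9)          ≡⟨ cong (_^ (9 + 9)) {3 + j} {t + 30} 3+j≡t+30 ⟩
    (t + 30) ^ (9 + 9)         ≤⟨ [t+n]^k≤4^t*n^k t {30} {9 + 9} (≤ᵇ⇒≤ 72 90 _) ⟩
    4 ^ t * 30 ^ (9 + 9)       ≤⟨ *-monoʳ-≤ (4 ^ t) {30 ^ (9 + 9)} {4 ^ 57} (≤ᵇ⇒≤ _ _ _) ⟩
    4 ^ t * 4 ^ 57             ≡⟨ sym (^-distribˡ-+-* 4 t 57) ⟩
    4 ^ (t + 57)               ≤⟨ ^-monoʳ-≤ 4 t+57≤3+2j ⟩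
    4 ^ (3 + 2 * j)            ∎
    where
    open ≤-Reasoning
    t = j ∸ 27
    t+27≡j : t + 27 ≡ j
    t+27≡j = m∸n+n≡m 27≤j
    3+j≡t+30 : 3 + j ≡ t + 30
    3+j≡t+30 = trans (+-comm 3 j) (trans (cong (_+ 3) (sym t+27≡j)) (+-assoc t 27 3))
    t+57≤3+2j : t + 57 ≤ 3 + 2 * j
    t+57≤3+2j = begin
      t + 57       ≡⟨ sym (+-assoc t 27 30) ⟩
      t + 27 + 30  ≡⟨ cong (_+ 30) t+27≡j ⟩
      j + 30       ≤⟨ +-monoʳ-≤ j (+-monoʳ-≤ 3 27≤j) ⟩
      j + (3 + j)  ≡⟨ solve (j ∷ []) ⟩
      3 + 2 * j    ∎

  -- Unification unfolds Bound, so its implicit arguments are passed explicitly below: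
  -- inferring them would evaluate 2 ^ 14 * 64 ^ n.
  Bound : ℕ → ℕ → ℕ → Set
  Bound n j d = (2 * n) ^ (9 * j) * 4 ^ d ≤ 2 ^ 14 * 64 ^ n

  bound-suc : ∀ {n j d} → 4 * (9 * j) ≤ 3 * n → Bound n j d →
              (2 * suc n) ^ (9 * j) * 4 ^ d ≤ 4 * (2 ^ 14 * 64 ^ n)
  bound-suc {n} {j} {d} 36j≤3n bound = begin
    (2 * suc n) ^ (9 * j) * 4 ^ d    ≤⟨ *-monoˡ-≤ (4 ^ d) ([2+2n]^k≤4*[2n]^k {n} (9 * j) 36j≤3n) ⟩
    4 * (2 * n) ^ (9 * j) * 4 ^ d    ≡⟨ *-assoc 4 ((2 * n) ^ (9 * j)) (4 ^ d) ⟩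
    4 * ((2 * n) ^ (9 * j) * 4 ^ d)  ≤⟨ *-monoʳ-≤ 4 bound ⟩
    4 * (2 ^ 14 * 64 ^ n)            ∎
    where open ≤-Reasoning

  bound-stay : ∀ {n j d} → 4 * (9 * j) ≤ 3 * n → Bound n j d → Bound (suc n) j (2 + d)
  bound-stay {n} {j} {d} 36j≤3n bound = begin
    a * 4 ^ (2 + d)                    ≡⟨ cong (a *_) (^-distribˡ-+-* 4 2 d) ⟩
    a * (4 ^ 2 * 4 ^ d)                ≡⟨ x∙yz≈y∙xz a (4 ^ 2) (4 ^ d) ⟩
    4 ^ 2 * (a * 4 ^ d)                ≤⟨ *-monoʳ-≤ (4 ^ 2) (bound-suc {n} {j} {d} 36j≤3n bound) ⟩
    4 ^ 2 * (4 * (2 ^ 14 * 64 ^ n))    ≡⟨ regroup (2 ^ 14) (64 ^ n) ⟩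
    2 ^ 14 * 64 ^ suc n                ∎
    where
    open ≤-Reasoning
    a = (2 * suc n) ^ (9 * j)
    regroup : ∀ x y → 4 ^ 2 * (4 * (x * y)) ≡ x * (64 * y)
    regroup = solve-∀

  bound-next : ∀ {n j d} → 4 * (9 * j) ≤ 3 * n → 27 ≤ j → 2 * suc n < (3 + j) * (3 + j) →
               Bound n j (1 + 2 * j + d) → Bound (suc n) (suc j) d
  bound-next {n} {j} {d} 36j≤3n 27≤j 2[1+n]<[3+j]² bound =
    *-cancelʳ-≤ _ _ (4 ^ k) {{m^n≢0 4 k}} (begin
      (2 * suc n) ^ (9 * suc j) * 4 ^ d * 4 ^ k
        ≡⟨ cong (λ e → (2 * suc n) ^ e * 4 ^ d * 4 ^ k) {9 * suc j} {9 + 9 * j} (*-suc 9 j) ⟩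
      (2 * suc n) ^ (9 + 9 * j) * 4 ^ d * 4 ^ k
        ≡⟨ cong (λ x → x * 4 ^ d * 4 ^ k) (^-distribˡ-+-* (2 * suc n) 9 (9 * j)) ⟩
      (2 * suc n) ^ 9 * (2 * suc n) ^ (9 * j) * 4 ^ d * 4 ^ k
        ≡⟨ regroup₁ ((2 * suc n) ^ 9) ((2 * suc n) ^ (9 * j)) (4 ^ d) (4 ^ k) ⟩
      (2 * suc n) ^ (9 * j) * (4 ^ k * 4 ^ d) * (2 * suc n) ^ 9
        ≡⟨ cong (λ x → (2 * suc n) ^ (9 * j) * x * (2 * suc n) ^ 9) (sym (^-distribˡ-+-* 4 k d)) ⟩
      (2 * suc n) ^ (9 * j) * 4 ^ (k + d) * (2 * suc n) ^ 9
        ≤⟨ *-mono-≤ (bound-suc {n} {j} {k + d} 36j≤3n bound) [2+2n]^9≤4^[3+2j] ⟩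
      4 * (2 ^ 14 * 64 ^ n) * 4 ^ (2 + k)
        ≡⟨ cong (4 * (2 ^ 14 * 64 ^ n) *_) (^-distribˡ-+-* 4 2 k) ⟩
      4 * (2 ^ 14 * 64 ^ n) * (4 ^ 2 * 4 ^ k)
        ≡⟨ regroup₂ (2 ^ 14) (64 ^ n) (4 ^ k) ⟩
      2 ^ 14 * 64 ^ suc n * 4 ^ k           ∎)
    where
    open ≤-Reasoning
    k = 1 + 2 * j
    regroup₁ : ∀ x y z w → x * y * z * w ≡ y * (w * z) * x
    regroup₁ = solve-∀
    regroup₂ : ∀ x y z → 4 * (x * y) * (4 ^ 2 * z) ≡ x * (64 * y) * z
    regroup₂ = solve-∀
    [2+2n]^9≤4^[3+2j] : (2 * suc n) ^ 9 ≤ 4 ^ (3 + 2 * j)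
    [2+2n]^9≤4^[3+2j] = ≤-trans (^-monoˡ-≤ 9 (<⇒≤ 2[1+n]<[3+j]²)) ([3+j]²^9≤4^[3+2j] 27≤j)

  4*[9j]≤3*n : ∀ {n j} → 27 ≤ j → suc j * suc j ≤ 2 * n → 4 * (9 * j) ≤ 3 * n
  4*[9j]≤3*n {n} {j} 27≤j [1+j]²≤2n = *-cancelˡ-≤ 2 (begin
    2 * (4 * (9 * j))    ≡⟨ solve (j ∷ []) ⟩
    3 * (24 * j)         ≤⟨ *-monoʳ-≤ 3 (*-monoˡ-≤ j (≤-trans (≤ᵇ⇒≤ 24 27 _) 27≤j)) ⟩
    3 * (j * j)          ≤⟨ *-monoʳ-≤ 3 (*-mono-≤ (n≤1+n j) (n≤1+n j)) ⟩
    3 * (suc j * suc j)  ≤⟨ *-monoʳ-≤ 3 [1+j]²≤2n ⟩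
    3 * (2 * n)          ≡⟨ x∙yz≈y∙xz 3 2 n ⟩
    2 * (3 * n)          ∎)
    where open ≤-Reasoning

  record Invariant (n : ℕ) : Set where
    constructor invariant
    field
      j d         : ℕ
      [1+j]²+d≡2n : suc j * suc j + d ≡ 2 * n
      2n<[2+j]²   : 2 * n < suc (suc j) * suc (suc j)
      27≤j        : 27 ≤ j
      bound       : Bound n j d

  invariant-suc : ∀ {n} → Invariant n → Invariant (suc n)
  invariant-suc {n} (invariant j d [1+j]²+d≡2n 2n<[2+j]² 27≤j bound) =
    case suc (suc j) * suc (suc j) ≤? 2 * suc n of λ where
      (no [2+j]²≰2[1+n]) →
        invariant j (2 + d) [1+j]²+[2+d]≡2[1+n] (≰⇒> [2+j]²≰2[1+n]) 27≤j
          (bound-stay {n} {j} {d} 36j≤3n bound)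
      (yes [2+j]²≤2[1+n]) →
        invariant (suc j) d′ (m+[n∸m]≡n [2+j]²≤2[1+n]) 2[1+n]<[3+j]² (m≤n⇒m≤1+n 27≤j)
          (bound-next {n} {j} {d′} 36j≤3n 27≤j 2[1+n]<[3+j]²
            (subst (Bound n j) (d≡1+2j+d′ (m+[n∸m]≡n [2+j]²≤2[1+n])) bound))
    where
    36j≤3n : 4 * (9 * j) ≤ 3 * n
    36j≤3n = 4*[9j]≤3*n {n} 27≤j (m+n≤o⇒m≤o _ (≤-reflexive [1+j]²+d≡2n))
    [1+j]²+[2+d]≡2[1+n] : suc j * suc j + (2 + d) ≡ 2 * suc n
    [1+j]²+[2+d]≡2[1+n] = begin
      suc j * suc j + (2 + d)  ≡⟨ solve (j ∷ d ∷ []) ⟩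
      2 + (suc j * suc j + d)  ≡⟨ cong (2 +_) [1+j]²+d≡2n ⟩
      2 + 2 * n                ≡⟨ sym (*-suc 2 n) ⟩
      2 * suc n                ∎
      where open ≡-Reasoning
    d′ : ℕ
    d′ = 2 * suc n ∸ suc (suc j) * suc (suc j)
    d≡1+2j+d′ : ∀ {d′} → suc (suc j) * suc (suc j) + d′ ≡ 2 * suc n → d ≡ 1 + 2 * j + d′
    d≡1+2j+d′ {d′} [2+j]²+d′≡2[1+n] = +-cancelˡ-≡ 2 _ _ (+-cancelˡ-≡ (suc j * suc j) _ _ (begin
      suc j * suc j + (2 + d)                  ≡⟨ [1+j]²+[2+d]≡2[1+n] ⟩
      2 * suc n                                ≡⟨ sym [2+j]²+d′≡2[1+n] ⟩
      suc (suc j) * suc (suc j) + d′           ≡⟨ solve (j ∷ d′ ∷ []) ⟩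
      suc j * suc j + (2 + (1 + 2 * j + d′))   ∎))
      where open ≡-Reasoning
    2[1+n]<[3+j]² : 2 * suc n < (3 + j) * (3 + j)
    2[1+n]<[3+j]² = begin-strict
      2 * suc n                                  ≡⟨ *-suc 2 n ⟩
      2 + 2 * n                                  <⟨ +-monoʳ-< 2 2n<[2+j]² ⟩
      2 + suc (suc j) * suc (suc j)              ≤⟨ m≤m+n _ (3 + 2 * j) ⟩
      2 + suc (suc j) * suc (suc j) + (3 + 2 * j) ≡⟨ solve (j ∷ []) ⟩
      (3 + j) * (3 + j)                          ∎
      where open ≤-Reasoning

  404≤n⇒Invariant : ∀ {n} → 404 ≤ n → Invariant n
  404≤n⇒Invariant = go ∘ ≤⇒≤′
    where
    go : ∀ {n} → 404 ≤′ n → Invariant n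
    go ≤′-refl          = invariant 27 24 refl (≤ᵇ⇒≤ _ _ _) ≤-refl (≤ᵇ⇒≤ _ _ _)
    go (≤′-step 404≤′n) = invariant-suc (go 404≤′n)

  IsM-unique : ∀ {n m k} → IsM n m → k * k ≤ 2 * n → 2 * n < suc k * suc k → m ≡ k
  IsM-unique (m²≤2n , [1+m]²≰2n) k²≤2n 2n<[1+k]² = ≤-antisym
    (≮⇒≥ λ k<m → <⇒≱ 2n<[1+k]² (≤-trans (*-mono-≤ k<m k<m) m²≤2n))
    (≮⇒≥ λ m<k → [1+m]²≰2n (≤-trans (*-mono-≤ m<k m<k) k²≤2n))

  exponent-gap : ∀ {n z j e} → 3 * z < 2 * n → e + 2 * z + suc j ≡ 2 * n + 2 →
                 14 + 6 * n < 9 * j + 9 * e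
  exponent-gap {n} {z} {j} {e} 3z<2n e+2z+1+j≡2n+2 = +-cancelʳ-≤ (6 * (2 * n) + 3) _ _ (begin
    15 + 6 * n + (6 * (2 * n) + 3)         ≡⟨ solve (n ∷ []) ⟩
    9 * (2 * n + 2)                        ≡⟨ cong (9 *_) (sym e+2z+1+j≡2n+2) ⟩
    9 * (e + 2 * z + suc j)                ≡⟨ solve (e ∷ z ∷ j ∷ []) ⟩
    9 * j + 9 * e + (6 * suc (3 * z) + 3)  ≤⟨ +-monoʳ-≤ (9 * j + 9 * e) (+-monoˡ-≤ 3 (*-monoʳ-≤ 6 3z<2n)) ⟩
    9 * j + 9 * e + (6 * (2 * n) + 3)      ∎)
    where open ≤-Reasoning

  n^j<2^e : ∀ {n j d e} → Bound n j d → 14 + 6 * n < 9 * j + 9 * e → n ^ j < 2 ^ e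
  n^j<2^e {n} {j} {d} {e} bound gap = ≰⇒> λ 2^e≤n^j → <⇒≱ n^[9j]<2^[9e] (begin
    2 ^ (9 * e)  ≡⟨ cong (2 ^_) (*-comm 9 e) ⟩
    2 ^ (e * 9)  ≡⟨ sym (^-*-assoc 2 e 9) ⟩
    (2 ^ e) ^ 9  ≤⟨ ^-monoˡ-≤ 9 2^e≤n^j ⟩
    (n ^ j) ^ 9  ≡⟨ ^-*-assoc n j 9 ⟩
    n ^ (j * 9)  ≡⟨ cong (n ^_) (*-comm j 9) ⟩
    n ^ (9 * j)  ∎)
    where
    open ≤-Reasoning
    n^[9j]<2^[9e] : n ^ (9 * j) < 2 ^ (9 * e)
    n^[9j]<2^[9e] = *-cancelˡ-< (2 ^ (9 * j)) _ _ (begin-strict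
      2 ^ (9 * j) * n ^ (9 * j)        ≡⟨ sym (^-distribʳ-* 2 n (9 * j)) ⟩
      (2 * n) ^ (9 * j)                ≤⟨ m≤m*n ((2 * n) ^ (9 * j)) (4 ^ d) {{m^n≢0 4 d}} ⟩
      (2 * n) ^ (9 * j) * 4 ^ d        ≤⟨ bound ⟩
      2 ^ 14 * 64 ^ n                  ≡⟨ cong (2 ^ 14 *_) (^-*-assoc 2 6 n) ⟩
      2 ^ 14 * 2 ^ (6 * n)             ≡⟨ sym (^-distribˡ-+-* 2 14 (6 * n)) ⟩
      2 ^ (14 + 6 * n)                 <⟨ ^-monoʳ-< 2 (n<1+n 1) gap ⟩
      2 ^ (9 * j + 9 * e)              ≡⟨ ^-distribˡ-+-* 2 (9 * j) (9 * e) ⟩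
      2 ^ (9 * j) * 2 ^ (9 * e)        ∎)

open import Data.Nat using (ℕ; zero; suc; _≤_; _+_; _*_; _∸_)
open import Data.Integer using (ℤ; +_; _-_; _^_) renaming (_<_ to _<ℤ_)
import Data.Nat as ℕ
import Data.Nat.Properties as ℕ
import Data.Integer as ℤ
open import Data.Integer.Properties using (pos-*; m-n≡m⊖n; ⊖-≥)

+a^k≡+[a^k] : ∀ a k → (+ a) ^ k ≡ + (a ℕ.^ k)
+a^k≡+[a^k] a zero    = refl
+a^k≡+[a^k] a (suc k) = trans (cong (+ a ℤ.*_) (+a^k≡+[a^k] a k)) (sym (pos-* a (a ℕ.^ k)))

a^l<b^k⇒0<+b^k-+a^l : ∀ {a b k l} → a ℕ.^ l ℕ.< b ℕ.^ k → + 0 <ℤ (+ b) ^ k - (+ a) ^ l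
a^l<b^k⇒0<+b^k-+a^l {a} {b} {k} {l} a^l<b^k
  rewrite +a^k≡+[a^k] b k | +a^k≡+[a^k] a l | m-n≡m⊖n (b ℕ.^ k) (a ℕ.^ l) | ⊖-≥ (ℕ.<⇒≤ a^l<b^k)
  = ℤ.+<+ (ℕ.m<n⇒0<n∸m a^l<b^k)

proposition2p6 : (n z m : ℕ) → 404 ≤ n → IsZ n z → IsM n m →
    (e : ℕ) → e + 2 * z + m ≡ 2 * n + 2 →
    + 0 <ℤ (+ 2) ^ e - (+ n) ^ (m ∸ 1)
proposition2p6 n z m 404≤n (3z<2n , _) isM e e+2z+m≡2n+2
  with invariant j d [1+j]²+d≡2n 2n<[2+j]² _ bound ← 404≤n⇒Invariant 404≤n
  with refl ← IsM-unique {n} {m} {suc j} isM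
                (ℕ.m+n≤o⇒m≤o _ (ℕ.≤-reflexive [1+j]²+d≡2n)) 2n<[2+j]²
  = a^l<b^k⇒0<+b^k-+a^l {n} {2} {e} {j}
      (n^j<2^e {n} {j} {d} {e} bound (exponent-gap {n} {z} {j} {e} 3z<2n e+2z+m≡2n+2))
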